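{- Let $F(u,v)=\sum_{p,q\geq1}F_{p,q}(t)u^pv^q$, where $F_{p,q}(t)=\sum_{n\geq1}|\{e\in\mathbf{I}_n(\mathcal{AW}): e\text{ has parameters }(p,q)\}|\,t^n$. Then $$F(u,v)=tuv+\frac{tuv}{v-u}\bigl(F(v,1)-F(u,1)\bigr)+\frac{tuv}{1-u}\bigl(F(u,1)-F(u,u)\bigr).$$ Equivalently, writing $F(u,v)=\sum_{n\geq1}f_n(u,v)t^n$, one has $f_1(u,v)=uv$ and for $n\geq2$, $$f_n(u,v)=\frac{uv}{v-u}\bigl(f_{n-1}(v,1)-f_{n-1}(u,1)\bigr)+\frac{uv}{1-u}\bigl(f_{n-1}(u,1)-f_{n-1}(u,u)\bigr).$$
   Context: $\mathbf{I}_n=\{(e_1,\ldots,e_n): 0\leq e_i<i\}$ is the set of inversion sequences of length $n$. An inversion sequence is an $\mathcal{AW}$-inversion sequence if $e_i\leq\max\{e_{i-2},e_{i-1}\}+1$ for every $2<i\leq n$; $\mathbf{I}_n(\mathcal{AW})$ denotes the set of these. For $e\in\mathbf{I}_n(\mathcal{AW})$, its parameters are $(p,q)$ with $p=e_n+1$ and $q=\max\{e_{n-1},e_n\}+1-e_n$, where $e_0:=0$ by convention (relevant only for $n=1$). -}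

module Defs where

open import Data.Bool using (Bool; true; false; _∧_)
open import Data.Nat using (ℕ; zero; suc; _≤ᵇ_; _⊔_; _∸_) renaming (_+_ to _+ℕ_)
open import Data.List using (List; []; _∷_; _++_; [_]; map; concatMap; upTo; filterᵇ; reverse)
open import Data.Product using (_×_; _,_)
open import Data.Integer using (ℤ; +_; _*_; _^_; _+_)

-- All inversion sequences of length n, as lists (e₁, …, eₙ) with 0 ≤ eᵢ < i.
-- invSeqs (n+1) = { e ++ [x] : e ∈ invSeqs n, x ∈ {0, …, n} }.
invSeqs : ℕ → List (List ℕ)
invSeqs zero    = [] ∷ []
invSeqs (suc n) = concatMap (λ e → map (λ x → e ++ [ x ]) (upTo (suc n))) (invSeqs n)

isAW : List ℕ → Bool
isAW (a ∷ b ∷ c ∷ rest) = (c ≤ᵇ ((a ⊔ b) +ℕ 1)) ∧ isAW (b ∷ c ∷ rest)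
isAW _                  = true

awSeqs : ℕ → List (List ℕ)
awSeqs n = filterᵇ isAW (invSeqs n)

-- Parameters (p, q) with p = e_n + 1, q = max(e_{n-1}, e_n) + 1 - e_n,
-- convention e_0 = 0 (only relevant for n = 1).
params : List ℕ → ℕ × ℕ
params e with reverse e
... | x ∷ y ∷ _ = (x +ℕ 1 , ((y ⊔ x) +ℕ 1) ∸ x)
... | x ∷ []    = (x +ℕ 1 , ((0 ⊔ x) +ℕ 1) ∸ x)
... | []        = (0 , 0)   -- never used (n ≥ 1)

-- The polynomial f_n(u,v) = Σ_{e ∈ I_n(AW)} u^p(e) v^q(e)
-- = Σ_{p,q} |{e ∈ I_n(AW) with parameters (p,q)}| u^p v^q, evaluated at integers u, v.
term : ℤ → ℤ → List ℕ → ℤ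
term u v e with params e
... | (p , q) = (u ^ p) * (v ^ q)

sumℤ : List ℤ → ℤ
sumℤ []       = + 0
sumℤ (x ∷ xs) = x + sumℤ xs

f : ℕ → ℤ → ℤ → ℤ
f n u v = sumℤ (map (term u v) (awSeqs n))

-- An AW-sequence e of length n with parameters (p, q) has last entry y = p - 1 and
-- max(e_{n-1}, e_n) + 1 = p + q - 1 =: c, and its AW children are exactly e·x for
-- 0 ≤ x ≤ c.  For x ≤ y the child has weight u^(x+1) v^(y+1-x), and for y < x ≤ c it
-- has weight u^(x+1) v.  The children's weights therefore form two geometric sums,
--   uv (v^p - u^p) / (v - u)   and   uv (u^p - u^(p+q)) / (1 - u),
-- which are uv (f(v,1) - f(u,1)) / (v - u) and uv (f(u,1) - f(u,u)) / (1 - u) evaluated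
-- at the single sequence e.  Summing over all e of length n - 1 gives the recurrence,
-- stated with the denominators cleared.
module Submission where

open import Defs
open import Data.Nat using (ℕ; _≤_; _∸_)
open import Data.Integer using (ℤ; _*_; _-_; _+_; 1ℤ)
open import Data.Product using (_×_)
open import Relation.Binary.PropositionalEquality using (_≡_)

open import Data.Bool using (Bool; true; false; _∧_; if_then_else_)
import Data.Bool.Properties as 𝔹
open import Data.Nat using (zero; suc; _<_; _⊔_; _≤ᵇ_; z≤n; s≤s) renaming (_+_ to _+ℕ_)
import Data.Nat.Properties as ℕ
open import Data.Integer using (+_; _^_)
import Data.Integer.Properties as ℤ
open import Data.Integer.Tactic.RingSolver using (solve-∀)
open import Data.List
  using (List; []; _∷_; _++_; [_]; _∷ʳ_; map; concatMap; applyUpTo; upTo; filterᵇ; reverse; length)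
import Data.List.Properties as List
open import Data.List.Relation.Unary.All as All using (All; []; _∷_)
import Data.List.Relation.Unary.All.Properties as All
open import Data.Product using (Σ; _,_; proj₁; proj₂)
open import Data.Sum using (inj₁; inj₂)
open import Function using (_∘_)
open import Function.Bundles using (Equivalence)
open import Relation.Nullary.Decidable using (T?)
open import Relation.Binary.PropositionalEquality
  using (refl; sym; trans; cong; cong₂; subst; module ≡-Reasoning)
open ≡-Reasoning

private
  variable
    A B : Set

-- Finite sums

sumTo : ℕ → (ℕ → ℤ) → ℤ
sumTo zero    g = + 0
sumTo (suc n) g = g 0 + sumTo n (g ∘ suc)

sumTo-cong : ∀ n {g h : ℕ → ℤ} → (∀ {i} → i < n → g i ≡ h i) → sumTo n g ≡ sumTo n h
sumTo-cong zero    eq = refl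
sumTo-cong (suc n) eq = cong₂ _+_ (eq (s≤s z≤n)) (sumTo-cong n (eq ∘ s≤s))

sumTo-* : ∀ n k (g : ℕ → ℤ) → sumTo n (λ i → k * g i) ≡ k * sumTo n g
sumTo-* zero    k g = sym (ℤ.*-zeroʳ k)
sumTo-* (suc n) k g =
  trans (cong (λ s → k * g 0 + s) (sumTo-* n k (g ∘ suc))) (sym (ℤ.*-distribˡ-+ k (g 0) _))

sumTo-+ : ∀ m n (g : ℕ → ℤ) → sumTo (m +ℕ n) g ≡ sumTo m g + sumTo n (λ i → g (m +ℕ i))
sumTo-+ zero    n g = sym (ℤ.+-identityˡ _)
sumTo-+ (suc m) n g = trans (cong (λ s → g 0 + s) (sumTo-+ m n (g ∘ suc))) (sym (ℤ.+-assoc (g 0) _ _))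

sumℤ-++ : ∀ xs ys → sumℤ (xs ++ ys) ≡ sumℤ xs + sumℤ ys
sumℤ-++ []       ys = sym (ℤ.+-identityˡ _)
sumℤ-++ (x ∷ xs) ys = trans (cong (λ s → x + s) (sumℤ-++ xs ys)) (sym (ℤ.+-assoc x _ _))

sumℤ-applyUpTo : ∀ (g : A → ℤ) f n → sumℤ (map g (applyUpTo f n)) ≡ sumTo n (g ∘ f)
sumℤ-applyUpTo g f zero    = refl
sumℤ-applyUpTo g f (suc n) = cong (λ s → g (f 0) + s) (sumℤ-applyUpTo g (f ∘ suc) n)

sumℤ-concatMap : ∀ (g : B → ℤ) (h : A → List B) xs →
                 sumℤ (map g (concatMap h xs)) ≡ sumℤ (map (λ x → sumℤ (map g (h x))) xs)
sumℤ-concatMap g h []       = refl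
sumℤ-concatMap g h (x ∷ xs) = begin
  sumℤ (map g (h x ++ concatMap h xs))           ≡⟨ cong sumℤ (List.map-++ g (h x) (concatMap h xs)) ⟩
  sumℤ (map g (h x) ++ map g (concatMap h xs))   ≡⟨ sumℤ-++ (map g (h x)) _ ⟩
  sumℤ (map g (h x)) + sumℤ (map g (concatMap h xs))
    ≡⟨ cong (λ s → sumℤ (map g (h x)) + s) (sumℤ-concatMap g h xs) ⟩
  sumℤ (map g (h x)) + sumℤ (map (λ x → sumℤ (map g (h x))) xs) ∎

sumℤ-map-cong : ∀ {P : A → Set} {g h : A → ℤ} {xs} → All P xs → (∀ {x} → P x → g x ≡ h x) →
                sumℤ (map g xs) ≡ sumℤ (map h xs)
sumℤ-map-cong []         eq = refl
sumℤ-map-cong (px ∷ pxs) eq = cong₂ _+_ (eq px) (sumℤ-map-cong pxs eq)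

sumℤ-map-* : ∀ k (g : A → ℤ) xs → sumℤ (map (λ x → k * g x) xs) ≡ k * sumℤ (map g xs)
sumℤ-map-* k g []       = sym (ℤ.*-zeroʳ k)
sumℤ-map-* k g (x ∷ xs) =
  trans (cong (λ s → k * g x + s) (sumℤ-map-* k g xs)) (sym (ℤ.*-distribˡ-+ k (g x) _))

sumℤ-map-combination :
  ∀ α β (g₁ g₂ g₃ : A → ℤ) xs →
  sumℤ (map (λ x → α * (g₁ x - g₂ x) + β * (g₂ x - g₃ x)) xs)
    ≡ α * (sumℤ (map g₁ xs) - sumℤ (map g₂ xs)) + β * (sumℤ (map g₂ xs) - sumℤ (map g₃ xs))
sumℤ-map-combination α β g₁ g₂ g₃ []       = empty α β
  where
  empty : ∀ α β → + 0 ≡ α * (+ 0 - + 0) + β * (+ 0 - + 0)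
  empty = solve-∀
sumℤ-map-combination α β g₁ g₂ g₃ (x ∷ xs) =
  trans (cong (λ s → α * (g₁ x - g₂ x) + β * (g₂ x - g₃ x) + s)
              (sumℤ-map-combination α β g₁ g₂ g₃ xs))
        (step α β (g₁ x) (g₂ x) (g₃ x) _ _ _)
  where
  step : ∀ α β a b c A B C →
         (α * (a - b) + β * (b - c)) + (α * (A - B) + β * (B - C))
           ≡ α * ((a + A) - (b + B)) + β * ((b + B) - (c + C))
  step = solve-∀

-- Geometric sums

geometric-sum : ∀ u v k → (v - u) * sumTo (suc k) (λ i → u ^ i * v ^ (k ∸ i)) ≡ v ^ suc k - u ^ suc k
geometric-sum u v zero    = base u v
  where
  base : ∀ u v → (v - u) * (1ℤ * 1ℤ + + 0) ≡ v * 1ℤ - u * 1ℤ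
  base = solve-∀
geometric-sum u v (suc k) = begin
  (v - u) * (1ℤ * V + sumTo (suc k) (λ i → u * u ^ i * v ^ (k ∸ i)))
    ≡⟨ cong (λ s → (v - u) * (1ℤ * V + s)) shift ⟩
  (v - u) * (1ℤ * V + u * S)      ≡⟨ expand u v V S ⟩
  (v - u) * V + u * ((v - u) * S) ≡⟨ cong (λ s → (v - u) * V + u * s) (geometric-sum u v k) ⟩
  (v - u) * V + u * (V - U)       ≡⟨ collect u v V U ⟩
  v * V - u * U                   ∎
  where
  V = v ^ suc k
  U = u ^ suc k
  S = sumTo (suc k) (λ i → u ^ i * v ^ (k ∸ i))
  shift : sumTo (suc k) (λ i → u * u ^ i * v ^ (k ∸ i)) ≡ u * S
  shift = trans (sumTo-cong (suc k) (λ {i} _ → ℤ.*-assoc u (u ^ i) (v ^ (k ∸ i))))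
                (sumTo-* (suc k) u (λ i → u ^ i * v ^ (k ∸ i)))
  expand : ∀ u v V S → (v - u) * (1ℤ * V + u * S) ≡ (v - u) * V + u * ((v - u) * S)
  expand = solve-∀
  collect : ∀ u v V U → (v - u) * V + u * (V - U) ≡ v * V - u * U
  collect = solve-∀

geometric-sum₁ : ∀ u k → (1ℤ - u) * sumTo k (u ^_) ≡ 1ℤ - u ^ k
geometric-sum₁ u zero    = base u
  where
  base : ∀ u → (1ℤ - u) * + 0 ≡ 1ℤ - 1ℤ
  base = solve-∀
geometric-sum₁ u (suc k) = begin
  (1ℤ - u) * (1ℤ + sumTo k (λ i → u * u ^ i)) ≡⟨ cong (λ s → (1ℤ - u) * (1ℤ + s)) (sumTo-* k u (u ^_)) ⟩
  (1ℤ - u) * (1ℤ + u * S)                     ≡⟨ expand u S ⟩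
  1ℤ - u + u * ((1ℤ - u) * S)                 ≡⟨ cong (λ s → 1ℤ - u + u * s) (geometric-sum₁ u k) ⟩
  1ℤ - u + u * (1ℤ - u ^ k)                   ≡⟨ collect u (u ^ k) ⟩
  1ℤ - u * u ^ k                              ∎
  where
  S = sumTo k (u ^_)
  expand : ∀ u S → (1ℤ - u) * (1ℤ + u * S) ≡ 1ℤ - u + u * ((1ℤ - u) * S)
  expand = solve-∀
  collect : ∀ u U → 1ℤ - u + u * (1ℤ - U) ≡ 1ℤ - u * U
  collect = solve-∀

-- Weights of children

childWeight : ℤ → ℤ → ℕ → ℕ → ℤ
childWeight u v y x = u ^ (x +ℕ 1) * v ^ (((y ⊔ x) +ℕ 1) ∸ x)

childWeight-≤ : ∀ u v {y x} → x ≤ y → childWeight u v y x ≡ u * v * (u ^ x * v ^ (y ∸ x))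
childWeight-≤ u v {y} {x} x≤y = begin
  u ^ (x +ℕ 1) * v ^ (((y ⊔ x) +ℕ 1) ∸ x)
    ≡⟨ cong (λ m → u ^ (x +ℕ 1) * v ^ ((m +ℕ 1) ∸ x)) (ℕ.m≥n⇒m⊔n≡m x≤y) ⟩
  u ^ (x +ℕ 1) * v ^ ((y +ℕ 1) ∸ x)
    ≡⟨ cong (λ m → u ^ (x +ℕ 1) * v ^ m) (ℕ.+-∸-comm 1 x≤y) ⟩
  u ^ (x +ℕ 1) * v ^ ((y ∸ x) +ℕ 1)
    ≡⟨ cong₂ _*_ (ℤ.^-distribˡ-+-* u x 1) (ℤ.^-distribˡ-+-* v (y ∸ x) 1) ⟩
  u ^ x * (u * 1ℤ) * (v ^ (y ∸ x) * (v * 1ℤ))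
    ≡⟨ regroup u v (u ^ x) (v ^ (y ∸ x)) ⟩
  u * v * (u ^ x * v ^ (y ∸ x)) ∎
  where
  regroup : ∀ u v P Q → P * (u * 1ℤ) * (Q * (v * 1ℤ)) ≡ u * v * (P * Q)
  regroup = solve-∀

childWeight-> : ∀ u v y j → childWeight u v y (suc y +ℕ j) ≡ u ^ suc y * u * v * u ^ j
childWeight-> u v y j = begin
  u ^ (x +ℕ 1) * v ^ (((y ⊔ x) +ℕ 1) ∸ x)
    ≡⟨ cong (λ m → u ^ (x +ℕ 1) * v ^ ((m +ℕ 1) ∸ x)) (ℕ.m≤n⇒m⊔n≡n y≤x) ⟩
  u ^ (x +ℕ 1) * v ^ ((x +ℕ 1) ∸ x)
    ≡⟨ cong₂ _*_ (ℤ.^-distribˡ-+-* u x 1) (cong (v ^_) (ℕ.m+n∸m≡n x 1)) ⟩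
  u ^ (suc y +ℕ j) * (u * 1ℤ) * (v * 1ℤ)
    ≡⟨ cong (λ z → z * (u * 1ℤ) * (v * 1ℤ)) (ℤ.^-distribˡ-+-* u (suc y) j) ⟩
  u ^ suc y * u ^ j * (u * 1ℤ) * (v * 1ℤ)
    ≡⟨ regroup u v (u ^ suc y) (u ^ j) ⟩
  u ^ suc y * u * v * u ^ j ∎
  where
  x = suc y +ℕ j
  y≤x : y ≤ x
  y≤x = ℕ.≤-trans (ℕ.n≤1+n y) (ℕ.m≤m+n (suc y) j)
  regroup : ∀ u v P Q → P * Q * (u * 1ℤ) * (v * 1ℤ) ≡ P * u * v * Q
  regroup = solve-∀

childWeight-sum-split :
  ∀ u v y d →
  (v - u) * (1ℤ - u) * sumTo (suc y +ℕ suc d) (childWeight u v y)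
    ≡ u * v * (1ℤ - u) * (v ^ suc y - u ^ suc y)
      + u * v * (v - u) * (u ^ suc y - u ^ suc y * u ^ suc d)
childWeight-sum-split u v y d = begin
  K * sumTo (suc y +ℕ suc d) (childWeight u v y)
    ≡⟨ cong (K *_) (sumTo-+ (suc y) (suc d) (childWeight u v y)) ⟩
  K * (sumTo (suc y) (childWeight u v y) + sumTo (suc d) (λ j → childWeight u v y (suc y +ℕ j)))
    ≡⟨ cong (K *_) (cong₂ _+_ low high) ⟩
  K * (u * v * G₁ + u ^ suc y * u * v * G₂)
    ≡⟨ combine {v ^ suc y} {u ^ suc y} {u ^ suc d} (geometric-sum u v y) (geometric-sum₁ u (suc d)) ⟩
  u * v * (1ℤ - u) * (v ^ suc y - u ^ suc y) + u * v * (v - u) * (u ^ suc y - u ^ suc y * u ^ suc d) ∎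
  where
  K  = (v - u) * (1ℤ - u)
  G₁ = sumTo (suc y) (λ i → u ^ i * v ^ (y ∸ i))
  G₂ = sumTo (suc d) (u ^_)
  low : sumTo (suc y) (childWeight u v y) ≡ u * v * G₁
  low = trans (sumTo-cong (suc y) (childWeight-≤ u v ∘ ℕ.≤-pred))
              (sumTo-* (suc y) (u * v) (λ i → u ^ i * v ^ (y ∸ i)))
  high : sumTo (suc d) (λ j → childWeight u v y (suc y +ℕ j)) ≡ u ^ suc y * u * v * G₂
  high = trans (sumTo-cong (suc d) (λ {j} _ → childWeight-> u v y j)) (sumTo-* (suc d) (u ^ suc y * u * v) (u ^_))
  combine : ∀ {A B D G₁ G₂} → (v - u) * G₁ ≡ A - B → (1ℤ - u) * G₂ ≡ 1ℤ - D →
            K * (u * v * G₁ + B * u * v * G₂) ≡ u * v * (1ℤ - u) * (A - B) + u * v * (v - u) * (B - B * D)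
  combine {A} {B} {D} {G₁} {G₂} eq₁ eq₂ = begin
    K * (u * v * G₁ + B * u * v * G₂)
      ≡⟨ spread u v B G₁ G₂ ⟩
    u * v * (1ℤ - u) * ((v - u) * G₁) + u * v * (v - u) * B * ((1ℤ - u) * G₂)
      ≡⟨ cong₂ (λ s t → u * v * (1ℤ - u) * s + u * v * (v - u) * B * t) eq₁ eq₂ ⟩
    u * v * (1ℤ - u) * (A - B) + u * v * (v - u) * B * (1ℤ - D)
      ≡⟨ cong (λ s → u * v * (1ℤ - u) * (A - B) + s) (gather u v B D) ⟩
    u * v * (1ℤ - u) * (A - B) + u * v * (v - u) * (B - B * D) ∎
    where
    spread : ∀ u v B G₁ G₂ →
             (v - u) * (1ℤ - u) * (u * v * G₁ + B * u * v * G₂)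
               ≡ u * v * (1ℤ - u) * ((v - u) * G₁) + u * v * (v - u) * B * ((1ℤ - u) * G₂)
    spread = solve-∀
    gather : ∀ u v B D → u * v * (v - u) * B * (1ℤ - D) ≡ u * v * (v - u) * (B - B * D)
    gather = solve-∀

childWeight-sum :
  ∀ u v {y M} → y ≤ M →
  (v - u) * (1ℤ - u) * sumTo (suc (M +ℕ 1)) (childWeight u v y)
    ≡ u * v * (1ℤ - u) * (v ^ (y +ℕ 1) - u ^ (y +ℕ 1))
      + u * v * (v - u) * (u ^ (y +ℕ 1) - u ^ (y +ℕ 1) * u ^ ((M +ℕ 1) ∸ y))
childWeight-sum u v {y} {M} y≤M with M ∸ y | ℕ.m+[n∸m]≡n y≤M
... | d | refl = begin
  K * sumTo (suc ((y +ℕ d) +ℕ 1)) w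
    ≡⟨ cong (λ n → K * sumTo (suc n) w) (trans (ℕ.+-assoc y d 1) (cong (y +ℕ_) (ℕ.+-comm d 1))) ⟩
  K * sumTo (suc y +ℕ suc d) w
    ≡⟨ childWeight-sum-split u v y d ⟩
  u * v * (1ℤ - u) * (v ^ suc y - u ^ suc y) + u * v * (v - u) * (u ^ suc y - u ^ suc y * u ^ suc d)
    ≡⟨ cong₂ (λ p q → u * v * (1ℤ - u) * (v ^ p - u ^ p) + u * v * (v - u) * (u ^ p - u ^ p * u ^ q))
             (ℕ.+-comm 1 y) (sym excess) ⟩
  u * v * (1ℤ - u) * (v ^ (y +ℕ 1) - u ^ (y +ℕ 1))
    + u * v * (v - u) * (u ^ (y +ℕ 1) - u ^ (y +ℕ 1) * u ^ (((y +ℕ d) +ℕ 1) ∸ y)) ∎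
  where
  K = (v - u) * (1ℤ - u)
  w = childWeight u v y
  excess : ((y +ℕ d) +ℕ 1) ∸ y ≡ suc d
  excess = trans (cong (_∸ y) (ℕ.+-assoc y d 1)) (trans (ℕ.m+n∸m≡n y (d +ℕ 1)) (ℕ.+-comm d 1))

-- Last entries and parameters

-- Both functions are applied to reversed sequences; missing entries count as e₀ = 0.
head₀ : List ℕ → ℕ
head₀ []      = 0
head₀ (x ∷ _) = x

max₂ : List ℕ → ℕ
max₂ []      = 0
max₂ (y ∷ l) = head₀ l ⊔ y

awBound : List ℕ → ℕ
awBound e = max₂ (reverse e) +ℕ 1

awChildren : List ℕ → List (List ℕ)
awChildren e = applyUpTo (e ∷ʳ_) (suc (awBound e))

max₂-∷ʳ : ∀ l a → 2 ≤ length l → max₂ (l ∷ʳ a) ≡ max₂ l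
max₂-∷ʳ (y ∷ z ∷ l) a _         = refl
max₂-∷ʳ (y ∷ [])    a (s≤s ())

awBound-∷ : ∀ a t → 2 ≤ length t → awBound (a ∷ t) ≡ awBound t
awBound-∷ a t 2≤|t| = cong (_+ℕ 1) (begin
  max₂ (reverse (a ∷ t))  ≡⟨ cong max₂ (List.unfold-reverse a t) ⟩
  max₂ (reverse t ∷ʳ a)   ≡⟨ max₂-∷ʳ (reverse t) a (subst (2 ≤_) (sym (List.length-reverse t)) 2≤|t|) ⟩
  max₂ (reverse t)        ∎)

max₂-≤ : ∀ {n l} → All (_≤ n) l → max₂ l ≤ n
max₂-≤ []            = z≤n
max₂-≤ (py ∷ [])     = py
max₂-≤ (py ∷ pz ∷ _) = ℕ.⊔-lub pz py

-- The hypothesis only matters for sequences of length < 2, where AW imposes no condition.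
isAW-∷ʳ : ∀ e x → x ≤ length e → isAW (e ∷ʳ x) ≡ isAW e ∧ (x ≤ᵇ awBound e)
isAW-∷ʳ []          x z≤n = refl
isAW-∷ʳ (a ∷ [])    x x≤1 =
  sym (Equivalence.to 𝔹.T-≡ (ℕ.≤⇒≤ᵇ (ℕ.≤-trans x≤1 (ℕ.m≤n+m 1 a))))
isAW-∷ʳ (a ∷ b ∷ r) x _   = long a b r
  where
  long : ∀ a b r → isAW ((a ∷ b ∷ r) ∷ʳ x) ≡ isAW (a ∷ b ∷ r) ∧ (x ≤ᵇ awBound (a ∷ b ∷ r))
  long a b []      = 𝔹.∧-identityʳ _
  long a b (c ∷ r) = begin
    ok ∧ isAW ((b ∷ c ∷ r) ∷ʳ x)
      ≡⟨ cong (ok ∧_) (long b c r) ⟩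
    ok ∧ (isAW (b ∷ c ∷ r) ∧ (x ≤ᵇ awBound (b ∷ c ∷ r)))
      ≡⟨ sym (𝔹.∧-assoc ok _ _) ⟩
    (ok ∧ isAW (b ∷ c ∷ r)) ∧ (x ≤ᵇ awBound (b ∷ c ∷ r))
      ≡⟨ cong (λ n → (ok ∧ isAW (b ∷ c ∷ r)) ∧ (x ≤ᵇ n))
              (sym (awBound-∷ a (b ∷ c ∷ r) (s≤s (s≤s z≤n)))) ⟩
    (ok ∧ isAW (b ∷ c ∷ r)) ∧ (x ≤ᵇ awBound (a ∷ b ∷ c ∷ r)) ∎
    where
    ok = c ≤ᵇ ((a ⊔ b) +ℕ 1)

reverse-∷ : ∀ (a : ℕ) t → Σ ℕ λ y → Σ (List ℕ) λ l → reverse (a ∷ t) ≡ y ∷ l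
reverse-∷ a t with reverse t | List.unfold-reverse a t
... | []     | eq = a , [] , eq
... | z ∷ zs | eq = z , zs ∷ʳ a , eq

params-reverse : ∀ e {y l} → reverse e ≡ y ∷ l → params e ≡ (y +ℕ 1 , (max₂ (y ∷ l) +ℕ 1) ∸ y)
params-reverse e eq with reverse e
params-reverse e refl | y ∷ _ ∷ _ = refl
params-reverse e refl | y ∷ []    = refl

term-params : ∀ u v e → term u v e ≡ u ^ proj₁ (params e) * v ^ proj₂ (params e)
term-params u v e with params e
... | _ = refl

term-reverse : ∀ u v e {y l} → reverse e ≡ y ∷ l →
               term u v e ≡ u ^ (y +ℕ 1) * v ^ ((max₂ (y ∷ l) +ℕ 1) ∸ y)
term-reverse u v e eq =
  trans (term-params u v e) (cong (λ pq → u ^ proj₁ pq * v ^ proj₂ pq) (params-reverse e eq))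

term-∷ʳ : ∀ u v e x {y l} → reverse e ≡ y ∷ l → term u v (e ∷ʳ x) ≡ childWeight u v y x
term-∷ʳ u v e x eq = term-reverse u v (e ∷ʳ x) (trans (List.reverse-++ e [ x ]) (cong (x ∷_) eq))

-- Generating the AW sequences

filterᵇ-concatMap : ∀ (p : B → Bool) (h : A → List B) xs →
                    filterᵇ p (concatMap h xs) ≡ concatMap (filterᵇ p ∘ h) xs
filterᵇ-concatMap p h []       = refl
filterᵇ-concatMap p h (x ∷ xs) =
  trans (List.filter-++ (T? ∘ p) (h x) _) (cong (filterᵇ p (h x) ++_) (filterᵇ-concatMap p h xs))

filterᵇ-map : ∀ (p : B → Bool) (g : A → B) xs → filterᵇ p (map g xs) ≡ map g (filterᵇ (p ∘ g) xs)
filterᵇ-map p g []       = refl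
filterᵇ-map p g (x ∷ xs) with p (g x)
... | true  = cong (g x ∷_) (filterᵇ-map p g xs)
... | false = filterᵇ-map p g xs

filterᵇ-cong : ∀ {P : A → Set} {p q : A → Bool} {xs} → All P xs → (∀ {x} → P x → p x ≡ q x) →
               filterᵇ p xs ≡ filterᵇ q xs
filterᵇ-cong [] eq = refl
filterᵇ-cong {p = p} {q} {x ∷ _} (px ∷ pxs) eq with p x | q x | eq px
... | true  | .true  | refl = cong (x ∷_) (filterᵇ-cong pxs eq)
... | false | .false | refl = filterᵇ-cong pxs eq

filterᵇ-false : ∀ (xs : List A) → filterᵇ (λ _ → false) xs ≡ []
filterᵇ-false []       = refl
filterᵇ-false (_ ∷ xs) = filterᵇ-false xs

filterᵇ-≤ᵇ-upTo : ∀ {c k} → c < k → filterᵇ (_≤ᵇ c) (upTo k) ≡ upTo (suc c)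
filterᵇ-≤ᵇ-upTo {c} {suc k} c<1+k with ℕ.m<1+n⇒m<n∨m≡n c<1+k
... | inj₂ refl =
  List.filter-all (T? ∘ (_≤ᵇ c)) (All.map (ℕ.≤⇒≤ᵇ ∘ ℕ.≤-pred) (All.all-upTo (suc c)))
... | inj₁ c<k  = begin
  filterᵇ (_≤ᵇ c) (upTo (suc k))                   ≡⟨ cong (filterᵇ (_≤ᵇ c)) (sym (List.upTo-∷ʳ k)) ⟩
  filterᵇ (_≤ᵇ c) (upTo k ++ [ k ])                ≡⟨ List.filter-++ (T? ∘ (_≤ᵇ c)) (upTo k) [ k ] ⟩
  filterᵇ (_≤ᵇ c) (upTo k) ++ filterᵇ (_≤ᵇ c) [ k ] ≡⟨ cong₂ _++_ (filterᵇ-≤ᵇ-upTo c<k) reject ⟩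
  upTo (suc c) ++ []                               ≡⟨ List.++-identityʳ _ ⟩
  upTo (suc c)                                     ∎
  where
  reject : filterᵇ (_≤ᵇ c) [ k ] ≡ []
  reject = List.filter-reject (T? ∘ (_≤ᵇ c)) {x = k} {xs = []}
                              (λ k≤c → ℕ.<⇒≱ c<k (ℕ.≤ᵇ⇒≤ k c k≤c))

concatMap-if : ∀ (p : A → Bool) (h : A → List B) xs →
               concatMap (λ x → if p x then h x else []) xs ≡ concatMap h (filterᵇ p xs)
concatMap-if p h []       = refl
concatMap-if p h (x ∷ xs) with p x
... | true  = cong (h x ++_) (concatMap-if p h xs)
... | false = concatMap-if p h xs

concatMap-cong : ∀ {P : A → Set} {g h : A → List B} {xs} → All P xs → (∀ {x} → P x → g x ≡ h x) →
                 concatMap g xs ≡ concatMap h xs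
concatMap-cong []         eq = refl
concatMap-cong (px ∷ pxs) eq = cong₂ _++_ (eq px) (concatMap-cong pxs eq)

LengthBounded : ℕ → List ℕ → Set
LengthBounded n e = length e ≡ n × All (_< n) (reverse e)

invSeqs-lengthBounded : ∀ n → All (LengthBounded n) (invSeqs n)
invSeqs-lengthBounded zero    = (refl , []) ∷ []
invSeqs-lengthBounded (suc n) =
  All.concat⁺ (All.map⁺ (All.map extensions (invSeqs-lengthBounded n)))
  where
  extensions : ∀ {e} → LengthBounded n e → All (LengthBounded (suc n)) (map (e ∷ʳ_) (upTo (suc n)))
  extensions {e} (|e| , bounded) = All.map⁺ (All.map extension (All.all-upTo (suc n)))
    where
    extension : ∀ {x} → x < suc n → LengthBounded (suc n) (e ∷ʳ x)
    extension x<1+n =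
        trans (List.length-++ e) (trans (cong (_+ℕ 1) |e|) (ℕ.+-comm n 1))
      , subst (All (_< suc n)) (sym (List.reverse-++ e [ _ ])) (x<1+n ∷ All.map ℕ.m<n⇒m<1+n bounded)

filterᵇ-isAW-extensions :
  ∀ {m e} → LengthBounded (suc m) e →
  filterᵇ isAW (map (e ∷ʳ_) (upTo (suc (suc m)))) ≡ (if isAW e then awChildren e else [])
filterᵇ-isAW-extensions {m} {e} (|e| , bounded) = begin
  filterᵇ isAW (map (e ∷ʳ_) (upTo k))
    ≡⟨ filterᵇ-map isAW (e ∷ʳ_) (upTo k) ⟩
  map (e ∷ʳ_) (filterᵇ (isAW ∘ (e ∷ʳ_)) (upTo k))
    ≡⟨ cong (map (e ∷ʳ_)) (filterᵇ-cong (All.all-upTo k) (λ {x} x<k → isAW-∷ʳ e x (x≤|e| x<k))) ⟩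
  map (e ∷ʳ_) (filterᵇ (λ x → isAW e ∧ (x ≤ᵇ awBound e)) (upTo k))
    ≡⟨ select (isAW e) ⟩
  (if isAW e then awChildren e else []) ∎
  where
  k = suc (suc m)
  x≤|e| : ∀ {x} → x < k → x ≤ length e
  x≤|e| x<k = subst (_ ≤_) (sym |e|) (ℕ.≤-pred x<k)
  bound<k : awBound e < k
  bound<k = s≤s (ℕ.≤-trans (ℕ.+-monoˡ-≤ 1 (max₂-≤ (All.map ℕ.≤-pred bounded)))
                          (ℕ.≤-reflexive (ℕ.+-comm m 1)))
  select : ∀ b → map (e ∷ʳ_) (filterᵇ (λ x → b ∧ (x ≤ᵇ awBound e)) (upTo k))
                   ≡ (if b then awChildren e else [])
  select true  = trans (cong (map (e ∷ʳ_)) (filterᵇ-≤ᵇ-upTo bound<k)) (List.map-upTo (e ∷ʳ_) _)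
  select false = cong (map (e ∷ʳ_)) (filterᵇ-false (upTo k))

awSeqs-suc : ∀ m → awSeqs (suc (suc m)) ≡ concatMap awChildren (awSeqs (suc m))
awSeqs-suc m = begin
  filterᵇ isAW (concatMap (λ e → map (e ∷ʳ_) (upTo (suc (suc m)))) (invSeqs (suc m)))
    ≡⟨ filterᵇ-concatMap isAW _ (invSeqs (suc m)) ⟩
  concatMap (λ e → filterᵇ isAW (map (e ∷ʳ_) (upTo (suc (suc m))))) (invSeqs (suc m))
    ≡⟨ concatMap-cong (invSeqs-lengthBounded (suc m)) filterᵇ-isAW-extensions ⟩
  concatMap (λ e → if isAW e then awChildren e else []) (invSeqs (suc m))
    ≡⟨ concatMap-if isAW awChildren (invSeqs (suc m)) ⟩
  concatMap awChildren (awSeqs (suc m)) ∎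

children-recurrence :
  ∀ u v a t → let e = a ∷ t in
  (v - u) * (1ℤ - u) * sumℤ (map (term u v) (awChildren e))
    ≡ u * v * (1ℤ - u) * (term v 1ℤ e - term u 1ℤ e) + u * v * (v - u) * (term u 1ℤ e - term u u e)
children-recurrence u v a t with reverse-∷ a t
... | y , l , eq = begin
  K * sumℤ (map (term u v) (awChildren e))
    ≡⟨ cong (K *_) (sumℤ-applyUpTo (term u v) (e ∷ʳ_) (suc (awBound e))) ⟩
  K * sumTo (suc (awBound e)) (λ x → term u v (e ∷ʳ x))
    ≡⟨ cong (K *_) (sumTo-cong (suc (awBound e)) (λ {x} _ → term-∷ʳ u v e x eq)) ⟩
  K * sumTo (suc (awBound e)) (childWeight u v y)
    ≡⟨ cong (λ r → K * sumTo (suc (max₂ r +ℕ 1)) (childWeight u v y)) eq ⟩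
  K * sumTo (suc (M +ℕ 1)) (childWeight u v y)
    ≡⟨ childWeight-sum u v (ℕ.m≤n⊔m (head₀ l) y) ⟩
  u * v * (1ℤ - u) * (v ^ (y +ℕ 1) - u ^ (y +ℕ 1))
    + u * v * (v - u) * (u ^ (y +ℕ 1) - u ^ (y +ℕ 1) * u ^ ((M +ℕ 1) ∸ y))
    ≡⟨ sym (cong₂ (λ p q → u * v * (1ℤ - u) * (p - q) + u * v * (v - u) * (q - Q))
                  (term-at-1 v) (term-at-1 u)) ⟩
  u * v * (1ℤ - u) * (term v 1ℤ e - term u 1ℤ e)
    + u * v * (v - u) * (term u 1ℤ e - Q)
    ≡⟨ cong (λ r → u * v * (1ℤ - u) * (term v 1ℤ e - term u 1ℤ e) + u * v * (v - u) * (term u 1ℤ e - r))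
            (sym (term-reverse u u e eq)) ⟩
  u * v * (1ℤ - u) * (term v 1ℤ e - term u 1ℤ e) + u * v * (v - u) * (term u 1ℤ e - term u u e) ∎
  where
  e = a ∷ t
  K = (v - u) * (1ℤ - u)
  M = max₂ (y ∷ l)
  Q = u ^ (y +ℕ 1) * u ^ ((M +ℕ 1) ∸ y)
  term-at-1 : ∀ z → term z 1ℤ e ≡ z ^ (y +ℕ 1)
  term-at-1 z = trans (term-reverse z 1ℤ e eq)
                      (trans (cong (z ^ (y +ℕ 1) *_) (ℤ.^-zeroˡ ((M +ℕ 1) ∸ y)))
                             (ℤ.*-identityʳ (z ^ (y +ℕ 1))))

f-recurrence :
  ∀ m u v →
  (v - u) * (1ℤ - u) * f (suc (suc m)) u v
    ≡ u * v * (1ℤ - u) * (f (suc m) v 1ℤ - f (suc m) u 1ℤ)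
      + u * v * (v - u) * (f (suc m) u 1ℤ - f (suc m) u u)
f-recurrence m u v = begin
  K * sumℤ (map (term u v) (awSeqs (suc (suc m))))
    ≡⟨ cong (λ es → K * sumℤ (map (term u v) es)) (awSeqs-suc m) ⟩
  K * sumℤ (map (term u v) (concatMap awChildren parents))
    ≡⟨ cong (K *_) (sumℤ-concatMap (term u v) awChildren parents) ⟩
  K * sumℤ (map (λ e → sumℤ (map (term u v) (awChildren e))) parents)
    ≡⟨ sym (sumℤ-map-* K _ parents) ⟩
  sumℤ (map (λ e → K * sumℤ (map (term u v) (awChildren e))) parents)
    ≡⟨ sumℤ-map-cong (All.filter⁺ (T? ∘ isAW) (invSeqs-lengthBounded (suc m))) (λ {e} → per-parent {e}) ⟩
  sumℤ (map (λ e → α * (term v 1ℤ e - term u 1ℤ e) + β * (term u 1ℤ e - term u u e)) parents)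
    ≡⟨ sumℤ-map-combination α β (term v 1ℤ) (term u 1ℤ) (term u u) parents ⟩
  α * (f (suc m) v 1ℤ - f (suc m) u 1ℤ) + β * (f (suc m) u 1ℤ - f (suc m) u u) ∎
  where
  K = (v - u) * (1ℤ - u)
  α = u * v * (1ℤ - u)
  β = u * v * (v - u)
  parents = awSeqs (suc m)
  per-parent : ∀ {e} → LengthBounded (suc m) e →
             K * sumℤ (map (term u v) (awChildren e))
               ≡ α * (term v 1ℤ e - term u 1ℤ e) + β * (term u 1ℤ e - term u u e)
  per-parent {a ∷ t} _ = children-recurrence u v a t

proposition5p2 : ((u v : ℤ) → f 1 u v ≡ u * v)
    × ((n : ℕ) → 2 ≤ n → (u v : ℤ) →
    (v - u) * (1ℤ - u) * f n u v
    ≡ u * v * (1ℤ - u) * (f (n ∸ 1) v 1ℤ - f (n ∸ 1) u 1ℤ)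
    + u * v * (v - u) * (f (n ∸ 1) u 1ℤ - f (n ∸ 1) u u))
proposition5p2 = f-1 , λ { (suc (suc m)) _ → f-recurrence m ; (suc zero) (s≤s ()) }
  where
  -- I₁(AW) = {(0)}, whose weight u¹ v¹ is the left-hand side after unfolding.
  f-1 : ∀ u v → u * 1ℤ * (v * 1ℤ) + + 0 ≡ u * v
  f-1 = solve-∀
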